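{- Let $N\ge1$ and let $\mathbf{B}$ be an $N\times N$ bi-stochastic matrix. Then there exists an $N\times N$ permutation matrix $\mathbf{P}$ such that every entry of $\mathbf{B}$ on the support of $\mathbf{P}$ is at least $$2\alpha(N)=\begin{cases}\frac{4}{N(N+2)} & N\text{ even},\\ \frac{4}{(N+1)^2} & N\text{ odd}.\end{cases}$$
   Context: A matrix is bi-stochastic if all its entries are non-negative and every row sum and every column sum equals one. -}

module Defs where

open import Level using (Level; _⊔_) renaming (suc to lsuc)
open import Data.Nat as ℕ using (ℕ; zero; suc)
open import Data.Fin using (Fin)
open import Data.Fin.Permutation using (Permutation′; _⟨$⟩ʳ_)
open import Data.Product using (_×_)
open import Relation.Binary.PropositionalEquality using (_≡_)
open import Relation.Nullary using (¬_; yes; no)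
open import Relation.Binary.Core using (Rel)
open import Relation.Binary.Structures using (IsTotalOrder)
open import Algebra.Bundles using (CommutativeRing)
open import Data.Fin using (_≟_)

-- An ordered field (the real numbers ℝ are an instance).  The multiplicative inverse is a total operation whose
-- law is only required on non-zero elements.
record OrderedField c ℓ₁ ℓ₂ : Set (lsuc (c ⊔ ℓ₁ ⊔ ℓ₂)) where
  field
    commutativeRing : CommutativeRing c ℓ₁
  open CommutativeRing commutativeRing public
  infix 4 _≤_
  infix 9 _⁻¹
  field
    _≤_          : Rel Carrier ℓ₂
    isTotalOrder : IsTotalOrder _≈_ _≤_
    +-mono-≤     : ∀ {x y} z → x ≤ y → x + z ≤ y + z
    *-nonneg     : ∀ {x y} → 0# ≤ x → 0# ≤ y → 0# ≤ x * y
    0≉1          : ¬ (0# ≈ 1#)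
    _⁻¹          : Carrier → Carrier
    ⁻¹-inverse   : ∀ x → ¬ (x ≈ 0#) → x * (x ⁻¹) ≈ 1#

module _ {c ℓ₁ ℓ₂ : Level} (F : OrderedField c ℓ₁ ℓ₂) where
  open OrderedField F

  fromℕ : ℕ → Carrier
  fromℕ zero    = 0#
  fromℕ (suc n) = 1# + fromℕ n

  Matrix : ℕ → Set c
  Matrix N = Fin N → Fin N → Carrier

  Σ : ∀ {N} → (Fin N → Carrier) → Carrier
  Σ {zero}  v = 0#
  Σ {suc N} v = v Fin.zero + Σ (λ i → v (Fin.suc i))
    where import Data.Fin as Fin

  BiStochastic : ∀ {N} → Matrix N → Set (ℓ₁ ⊔ ℓ₂)
  BiStochastic {N} B =
    (∀ i j → 0# ≤ B i j)
    × (∀ i → Σ (λ j → B i j) ≈ 1#)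
    × (∀ j → Σ (λ i → B i j) ≈ 1#)

  permMatrix : ∀ {N} → Permutation′ N → Matrix N
  permMatrix σ i j with (σ ⟨$⟩ʳ i) ≟ j
  ... | yes _ = 1#
  ... | no  _ = 0#

  twoAlpha : ℕ → Carrier
  twoAlpha N with N ℕ.% 2
  ... | zero  = fromℕ 4 * (fromℕ (N ℕ.* (N ℕ.+ 2))) ⁻¹
  ... | suc _ = fromℕ 4 * (fromℕ ((N ℕ.+ 1) ℕ.* (N ℕ.+ 1))) ⁻¹

module Submission where

open import Defs
open import Level using (Level)
open import Data.Nat using (ℕ; _≥_)
open import Data.Product using (∃; _,_)
open import Relation.Nullary using (¬_)
open import Data.Fin.Permutation using (Permutation′)

-- Put t = 2α(N).  A marking records, for each entry, either a proof that it is
-- ≥ t ("marked") or a proof that it is ≤ t; totality of the order provides one.  By Hall's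
-- theorem in Frobenius–König form, either the marked entries contain a perfect matching,
-- which is the permutation sought, or there is a block S × T of unmarked entries with
-- ∣ S ∣ + ∣ T ∣ = N + 1.  The rows of S carry mass ∣ S ∣, of which the N − ∣ T ∣ = ∣ S ∣ − 1
-- columns outside T absorb at most ∣ S ∣ − 1, so the block has mass ≥ 1.  By AM–GM
-- (sharpened by parity for N even) t · ∣ S ∣ · ∣ T ∣ ≤ 1, and as all block entries are ≤ t,
-- each of them is in fact ≥ t (the block lemma).  Marking one of them and repeating
-- terminates, since the number of unmarked entries decreases.

module FiniteSubsets where

  open import Data.Bool using (Bool; true; false; _∧_; _∨_; not; if_then_else_)
  open import Data.Empty using (⊥-elim)
  open import Data.Fin using (Fin; zero; suc; _≟_)
  open import Data.Fin.Properties using (any?)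
  open import Data.Nat using (zero; suc; _+_; _≤_; _<_; z≤n; s≤s)
  open import Data.Nat.Properties using (+-0-commutativeMonoid; +-mono-≤; +-mono-<-≤; +-mono-≤-<; <-irrefl; 1+n≰n)
  open import Data.Product using (_×_; proj₁; proj₂)
  open import Data.Sum using (_⊎_; inj₁; inj₂)
  open import Relation.Binary.PropositionalEquality using (_≡_; _≢_; refl; sym; trans; cong; subst; subst₂)
  open import Relation.Nullary using (yes; no)
  open import Relation.Nullary.Decidable using (does)
  import Data.Bool.Properties as Bool
  open import Algebra.Properties.CommutativeMonoid.Sum +-0-commutativeMonoid using (sum; sum-cong-≗; sum-replicate-zero; ∑-distrib-+)

  𝟙 : Bool → ℕ
  𝟙 b = if b then 1 else 0

  Subset : ℕ → Set
  Subset n = Fin n → Bool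

  module _ {n : ℕ} where

    infix 4 _∈_ _∉_ _⊆_
    infixl 6 _∖_ _-_
    infixl 7 _∩_
    infixl 5 _∪_

    _∈_ _∉_ : Fin n → Subset n → Set
    i ∈ A = A i ≡ true
    i ∉ A = A i ≡ false

    _⊆_ : Subset n → Subset n → Set
    A ⊆ B = ∀ {i} → i ∈ A → i ∈ B

    full : Subset n
    full _ = true

    ⁅_⁆ : Fin n → Subset n
    ⁅ r ⁆ i = does (i ≟ r)

    _∩_ _∪_ _∖_ : Subset n → Subset n → Subset n
    (A ∩ B) i = A i ∧ B i
    (A ∪ B) i = A i ∨ B i
    (A ∖ B) i = A i ∧ not (B i)

    _-_ : Subset n → Fin n → Subset n
    A - r = A ∖ ⁅ r ⁆

    ∩⁺ : ∀ {A B i} → i ∈ A → i ∈ B → i ∈ A ∩ B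
    ∩⁺ {A} {B} {i} a b rewrite a | b = refl

    ∩⁻ : ∀ {A B i} → i ∈ A ∩ B → i ∈ A × i ∈ B
    ∩⁻ {A} {B} {i} h with A i | B i
    ... | true | true = refl , refl

    ∖⁺ : ∀ {A B i} → i ∈ A → i ∉ B → i ∈ A ∖ B
    ∖⁺ {A} {B} {i} a b rewrite a | b = refl

    ∖⁻ : ∀ {A B i} → i ∈ A ∖ B → i ∈ A × i ∉ B
    ∖⁻ {A} {B} {i} h with A i | B i
    ... | true | false = refl , refl

    ∖⊆ : ∀ {A B} → A ∖ B ⊆ A
    ∖⊆ {A} {B} h = proj₁ (∖⁻ {A} {B} h)

    ∪⁻ : ∀ {A B i} → i ∈ A ∪ B → i ∈ A ⊎ i ∈ B
    ∪⁻ {A} {B} {i} h with A i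
    ... | true  = inj₁ refl
    ... | false = inj₂ h

    ∈⁅⁆ : ∀ {r i} → i ∈ ⁅ r ⁆ → i ≡ r
    ∈⁅⁆ {r} {i} h with i ≟ r
    ... | yes i≡r = i≡r

    r∈⁅r⁆ : ∀ r → r ∈ ⁅ r ⁆
    r∈⁅r⁆ r with r ≟ r
    ... | yes _  = refl
    ... | no r≢r = ⊥-elim (r≢r refl)

    ≢⇒∉⁅⁆ : ∀ {r i} → i ≢ r → i ∉ ⁅ r ⁆
    ≢⇒∉⁅⁆ {r} {i} i≢r with i ≟ r
    ... | yes i≡r = ⊥-elim (i≢r i≡r)
    ... | no  _   = refl

    ∈-r : ∀ {A r i} → i ∈ A - r → i ≢ r
    ∈-r {A} {r} h refl with () ← trans (sym (r∈⁅r⁆ r)) (proj₂ (∖⁻ {A} {⁅ r ⁆} h))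

    nonempty? : ∀ A → (∃ λ i → i ∈ A) ⊎ ¬ (∃ λ i → i ∈ A)
    nonempty? A with any? (λ i → A i Bool.≟ true)
    ... | yes ne = inj₁ ne
    ... | no  e  = inj₂ e

  ∑-mono-≤ : ∀ {n} {f g : Fin n → ℕ} → (∀ i → f i ≤ g i) → sum f ≤ sum g
  ∑-mono-≤ {zero}  f≤g = z≤n
  ∑-mono-≤ {suc n} f≤g = +-mono-≤ (f≤g zero) (∑-mono-≤ (λ i → f≤g (suc i)))

  ∑-mono-< : ∀ {n} {f g : Fin n → ℕ} → (∀ i → f i ≤ g i) → ∀ k → f k < g k → sum f < sum g
  ∑-mono-< f≤g zero    fk<gk = +-mono-<-≤ fk<gk (∑-mono-≤ (λ i → f≤g (suc i)))
  ∑-mono-< f≤g (suc k) fk<gk = +-mono-≤-< (f≤g zero) (∑-mono-< (λ i → f≤g (suc i)) k fk<gk)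

  positive-summand : ∀ {a b c} → a + b ≡ suc c → b ≤ c → 0 < a
  positive-summand {zero}  refl 1+c≤c = ⊥-elim (1+n≰n 1+c≤c)
  positive-summand {suc _} _    _     = s≤s z≤n

  -- Cardinality: the number of elements of a subset.  It is kept opaque, so that
  -- cardinalities are only manipulated through the lemmas below.
  opaque
    ∣_∣ : ∀ {n} → Subset n → ℕ
    ∣ A ∣ = sum (λ i → 𝟙 (A i))

  module _ {n : ℕ} where

    𝟙-mono : ∀ {S P : Subset n} → S ⊆ P → ∀ i → 𝟙 (S i) ≤ 𝟙 (P i)
    𝟙-mono {S} S⊆P i with S i in i∈S
    ... | true rewrite S⊆P i∈S = s≤s z≤n
    ... | false = z≤n

    opaque
      unfolding ∣_∣

      ∣∣-additive : ∀ {A B C : Subset n} → (∀ i → 𝟙 (C i) ≡ 𝟙 (A i) + 𝟙 (B i)) → ∣ C ∣ ≡ ∣ A ∣ + ∣ B ∣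
      ∣∣-additive {A} {B} pointwise =
        trans (sum-cong-≗ {n} pointwise) (∑-distrib-+ {n} (λ i → 𝟙 (A i)) (λ i → 𝟙 (B i)))

      ∣∣-mono : ∀ {S P : Subset n} → S ⊆ P → ∣ S ∣ ≤ ∣ P ∣
      ∣∣-mono S⊆P = ∑-mono-≤ (𝟙-mono S⊆P)

      ∣∣-mono-< : ∀ {S P : Subset n} {k} → S ⊆ P → k ∈ P → k ∉ S → ∣ S ∣ < ∣ P ∣
      ∣∣-mono-< S⊆P k∈P k∉S =
        ∑-mono-< (𝟙-mono S⊆P) _ (subst₂ (λ a b → 𝟙 a < 𝟙 b) (sym k∉S) (sym k∈P) (s≤s z≤n))

      ∣∅∣ : ∀ {A : Subset n} → ¬ (∃ λ i → i ∈ A) → ∣ A ∣ ≡ 0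
      ∣∅∣ {A} empty = trans (sum-cong-≗ {n} pointwise) (sum-replicate-zero n)
        where
        pointwise : ∀ i → 𝟙 (A i) ≡ 0
        pointwise i with A i in i∈A
        ... | true  = ⊥-elim (empty (i , i∈A))
        ... | false = refl

    ∣∣-split : ∀ {S P : Subset n} → S ⊆ P → ∣ P ∣ ≡ ∣ S ∣ + ∣ P ∖ S ∣
    ∣∣-split {S} {P} S⊆P = ∣∣-additive pointwise
      where
      pointwise : ∀ i → 𝟙 (P i) ≡ 𝟙 (S i) + 𝟙 (P i ∧ not (S i))
      pointwise i with S i in i∈S
      ... | true  rewrite S⊆P i∈S = refl
      ... | false rewrite Bool.∧-identityʳ (P i) = refl

    ∣∣-∪ : ∀ {A B : Subset n} → (∀ {i} → i ∈ A → i ∉ B) → ∣ A ∪ B ∣ ≡ ∣ A ∣ + ∣ B ∣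
    ∣∣-∪ {A} {B} disjoint = ∣∣-additive pointwise
      where
      pointwise : ∀ i → 𝟙 (A i ∨ B i) ≡ 𝟙 (A i) + 𝟙 (B i)
      pointwise i with A i in i∈A
      ... | true rewrite disjoint i∈A = refl
      ... | false = refl

    positive⇒nonempty : ∀ {A : Subset n} → 0 < ∣ A ∣ → ∃ λ i → i ∈ A
    positive⇒nonempty {A} 0<∣A∣ with nonempty? A
    ... | inj₁ ne    = ne
    ... | inj₂ empty = ⊥-elim (<-irrefl (sym (∣∅∣ empty)) 0<∣A∣)

  opaque
    unfolding ∣_∣

    ∣full∣ : ∀ {n} → ∣ full {n} ∣ ≡ n
    ∣full∣ {zero}  = refl
    ∣full∣ {suc n} = cong suc (∣full∣ {n})

    ∣⁅r⁆∣ : ∀ {n} (r : Fin n) → ∣ ⁅ r ⁆ ∣ ≡ 1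
    ∣⁅r⁆∣ {suc n} zero    = cong suc (∣∅∣ {n} {λ i → ⁅ zero ⁆ (suc i)} (λ { (_ , ()) }))
    ∣⁅r⁆∣ {suc n} (suc r) = ∣⁅r⁆∣ r

  ∣∣-remove : ∀ {n} {P : Subset n} {r} → r ∈ P → ∣ P ∣ ≡ suc ∣ P - r ∣
  ∣∣-remove {P = P} {r} r∈P = trans (∣∣-split ⁅r⁆⊆P) (cong (_+ ∣ P - r ∣) (∣⁅r⁆∣ r))
    where
    ⁅r⁆⊆P : ⁅ r ⁆ ⊆ P
    ⁅r⁆⊆P i∈⁅r⁆ = subst (_∈ P) (sym (∈⁅⁆ {r = r} i∈⁅r⁆)) r∈P

  ∣∣-complement : ∀ {n} (T : Subset n) → ∣ T ∣ + ∣ full ∖ T ∣ ≡ n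
  ∣∣-complement T = trans (sym (∣∣-split (λ _ → refl))) ∣full∣

-- Hall's marriage theorem for a Boolean relation R on Fin n, in Frobenius–König form.
module Hall where

  open FiniteSubsets
  open import Data.Bool using (Bool; true; false; if_then_else_)
  open import Data.Empty using (⊥-elim)
  open import Data.Fin using (Fin; _≟_)
  open import Data.Nat using (suc; _+_; _≤_; _<_; s≤s⁻¹)
  open import Data.Nat.Properties using (+-comm; +-assoc; ≤-trans; <-≤-trans; ≤-<-trans; m<n+m)
  open import Data.Product using (proj₂)
  open import Data.Sum using (_⊎_; inj₁; inj₂; [_,_]′)
  open import Function using (id; case_of_)
  open import Relation.Binary.PropositionalEquality
  open import Relation.Nullary using (yes; no)

  module _ {n : ℕ} (R : Fin n → Fin n → Bool) where

    record Matching (P Q : Subset n) : Set where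
      field
        match     : Fin n → Fin n
        into      : ∀ {i} → i ∈ P → match i ∈ Q
        adjacent  : ∀ {i} → i ∈ P → R i (match i) ≡ true
        injective : ∀ {i k} → i ∈ P → k ∈ P → match i ≡ match k → i ≡ k

    record ZeroBlock (P Q : Subset n) (size : ℕ) : Set where
      field
        rows cols : Subset n
        rows⊆P    : rows ⊆ P
        cols⊆Q    : cols ⊆ Q
        vanishes  : ∀ {i j} → i ∈ rows → j ∈ cols → R i j ≡ false
        sized     : ∣ rows ∣ + ∣ cols ∣ ≡ size

    emptyMatching : ∀ {P Q} → ¬ (∃ λ i → i ∈ P) → Matching P Q
    emptyMatching empty = record
      { match     = id
      ; into      = λ {i} i∈P → ⊥-elim (empty (i , i∈P))
      ; adjacent  = λ {i} i∈P → ⊥-elim (empty (i , i∈P))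
      ; injective = λ {i} i∈P _ _ → ⊥-elim (empty (i , i∈P))
      }

    isolatedRow : ∀ {P Q r} → r ∈ P → (∀ {j} → j ∈ Q → R r j ≡ false) → ZeroBlock P Q (suc ∣ Q ∣)
    isolatedRow {P} {Q} {r} r∈P isolated = record
      { rows     = ⁅ r ⁆
      ; cols     = Q
      ; rows⊆P   = λ i∈⁅r⁆ → subst (_∈ P) (sym (∈⁅⁆ {r = r} i∈⁅r⁆)) r∈P
      ; cols⊆Q   = id
      ; vanishes = λ i∈⁅r⁆ j∈Q → subst (λ i → R i _ ≡ false) (sym (∈⁅⁆ {r = r} i∈⁅r⁆)) (isolated j∈Q)
      ; sized    = cong (_+ ∣ Q ∣) (∣⁅r⁆∣ r)
      }

    extendMatching : ∀ {P Q r j} → r ∈ P → j ∈ Q → R r j ≡ true →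
                     Matching (P - r) (Q - j) → Matching P Q
    extendMatching {P} {Q} {r} {j} r∈P j∈Q rRj m = record
      { match = match ; into = into ; adjacent = adjacent ; injective = injective }
      where
      module m = Matching m

      match : Fin n → Fin n
      match i with i ≟ r
      ... | yes _ = j
      ... | no  _ = m.match i

      rest : ∀ {i} → i ∈ P → i ≢ r → i ∈ P - r
      rest {i} i∈P i≢r = ∖⁺ {A = P} {B = ⁅ r ⁆} i∈P (≢⇒∉⁅⁆ i≢r)

      into : ∀ {i} → i ∈ P → match i ∈ Q
      into {i} i∈P with i ≟ r
      ... | yes _   = j∈Q
      ... | no  i≢r = ∖⊆ {A = Q} {B = ⁅ j ⁆} (m.into (rest i∈P i≢r))

      adjacent : ∀ {i} → i ∈ P → R i (match i) ≡ true
      adjacent {i} i∈P with i ≟ r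
      ... | yes refl = rRj
      ... | no  i≢r  = m.adjacent (rest i∈P i≢r)

      avoids-j : ∀ {i} → i ∈ P → i ≢ r → m.match i ≢ j
      avoids-j i∈P i≢r = ∈-r {A = Q} (m.into (rest i∈P i≢r))

      injective : ∀ {i k} → i ∈ P → k ∈ P → match i ≡ match k → i ≡ k
      injective {i} {k} i∈P k∈P eq with i ≟ r | k ≟ r
      ... | yes i≡r | yes k≡r = trans i≡r (sym k≡r)
      ... | yes _   | no  k≢r = ⊥-elim (avoids-j k∈P k≢r (sym eq))
      ... | no  i≢r | yes _   = ⊥-elim (avoids-j i∈P i≢r eq)
      ... | no  i≢r | no  k≢r = m.injective (rest i∈P i≢r) (rest k∈P k≢r) eq

    glueMatchings : ∀ {P Q S T} → T ⊆ Q → Matching S (Q ∖ T) → Matching (P ∖ S) T → Matching P Q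
    glueMatchings {P} {Q} {S} {T} T⊆Q m₁ m₂ = record
      { match = match ; into = into ; adjacent = adjacent ; injective = injective }
      where
      module m₁ = Matching m₁
      module m₂ = Matching m₂

      match : Fin n → Fin n
      match i = if S i then m₁.match i else m₂.match i

      outside : ∀ {i} → i ∈ P → i ∉ S → i ∈ P ∖ S
      outside = ∖⁺ {A = P} {B = S}

      into : ∀ {i} → i ∈ P → match i ∈ Q
      into {i} i∈P with S i in i∈S
      ... | true  = ∖⊆ {A = Q} {B = T} (m₁.into i∈S)
      ... | false = T⊆Q (m₂.into (outside i∈P i∈S))

      adjacent : ∀ {i} → i ∈ P → R i (match i) ≡ true
      adjacent {i} i∈P with S i in i∈S
      ... | true  = m₁.adjacent i∈S
      ... | false = m₂.adjacent (outside i∈P i∈S)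

      -- the two images are disjoint: the first avoids T, the second lies in T
      disjoint : ∀ {i k} → i ∈ S → k ∈ P ∖ S → m₁.match i ≢ m₂.match k
      disjoint {i} i∈S k∈P∖S eq =
        case trans (sym (m₂.into k∈P∖S)) (subst (_∉ T) eq (proj₂ (∖⁻ {A = Q} {B = T} (m₁.into i∈S)))) of λ ()

      injective : ∀ {i k} → i ∈ P → k ∈ P → match i ≡ match k → i ≡ k
      injective {i} {k} i∈P k∈P eq with S i in i∈S | S k in k∈S
      ... | true  | true  = m₁.injective i∈S k∈S eq
      ... | true  | false = ⊥-elim (disjoint i∈S (outside k∈P k∈S) eq)
      ... | false | true  = ⊥-elim (disjoint k∈S (outside i∈P i∈S) (sym eq))
      ... | false | false = m₂.injective (outside i∈P i∈S) (outside k∈P k∈S) eq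

    widen : ∀ {P P′ Q Q′ s s′} → P ⊆ P′ → Q ⊆ Q′ → s ≡ s′ → ZeroBlock P Q s → ZeroBlock P′ Q′ s′
    widen P⊆P′ Q⊆Q′ s≡s′ b = record
      { rows = rows ; cols = cols ; rows⊆P = λ i∈rows → P⊆P′ (rows⊆P i∈rows)
      ; cols⊆Q = λ j∈cols → Q⊆Q′ (cols⊆Q j∈cols) ; vanishes = vanishes ; sized = trans sized s≡s′ }
      where open ZeroBlock b

    -- An obstruction to matching P into Q has at least one row, since ∣ cols ∣ ≤ ∣ Q ∣.
    rows-nonempty : ∀ {P Q} (b : ZeroBlock P Q (suc ∣ Q ∣)) → 0 < ∣ ZeroBlock.rows b ∣
    rows-nonempty b = positive-summand sized (∣∣-mono {S = cols} cols⊆Q)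
      where
      open ZeroBlock b

    cols-nonempty : ∀ {P Q} → ∣ P ∣ ≤ ∣ Q ∣ → (b : ZeroBlock P Q (suc ∣ Q ∣)) → 0 < ∣ ZeroBlock.cols b ∣
    cols-nonempty ∣P∣≤∣Q∣ b =
      positive-summand (trans (+-comm ∣ cols ∣ ∣ rows ∣) sized) (≤-trans (∣∣-mono {S = rows} rows⊆P) ∣P∣≤∣Q∣)
      where open ZeroBlock b

    HallAlternative : Subset n → Subset n → Set
    HallAlternative P Q = Matching P Q ⊎ ZeroBlock P Q (suc ∣ Q ∣)

    module _ {P Q : Subset n} (b : ZeroBlock P Q ∣ Q ∣) where
      open ZeroBlock b renaming (rows to S; cols to T)

      growCols : ZeroBlock S (Q ∖ T) (suc ∣ Q ∖ T ∣) → ZeroBlock P Q (suc ∣ Q ∣)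
      growCols b′ = record
        { rows = S′ ; cols = T′ ∪ T
        ; rows⊆P = λ i∈S′ → rows⊆P (S′⊆S i∈S′)
        ; cols⊆Q = λ j∈T′∪T → [ (λ j∈T′ → ∖⊆ {A = Q} {B = T} (T′⊆Q∖T j∈T′)) , cols⊆Q ]′ (∪⁻ {A = T′} {T} j∈T′∪T)
        ; vanishes = λ i∈S′ j∈T′∪T → [ vanishes′ i∈S′ , vanishes (S′⊆S i∈S′) ]′ (∪⁻ {A = T′} {T} j∈T′∪T)
        ; sized = size
        }
        where
        open ZeroBlock b′ renaming (rows to S′; cols to T′; rows⊆P to S′⊆S; cols⊆Q to T′⊆Q∖T;
                                    vanishes to vanishes′; sized to sized′)
        size : ∣ S′ ∣ + ∣ T′ ∪ T ∣ ≡ suc ∣ Q ∣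
        size = begin
          ∣ S′ ∣ + ∣ T′ ∪ T ∣       ≡⟨ cong (∣ S′ ∣ +_) (∣∣-∪ {A = T′} {T} λ j∈T′ → proj₂ (∖⁻ {A = Q} {T} (T′⊆Q∖T j∈T′))) ⟩
          ∣ S′ ∣ + (∣ T′ ∣ + ∣ T ∣) ≡⟨ sym (+-assoc ∣ S′ ∣ _ _) ⟩
          ∣ S′ ∣ + ∣ T′ ∣ + ∣ T ∣   ≡⟨ cong (_+ ∣ T ∣) sized′ ⟩
          suc (∣ Q ∖ T ∣ + ∣ T ∣)   ≡⟨ cong suc (+-comm ∣ Q ∖ T ∣ _) ⟩
          suc (∣ T ∣ + ∣ Q ∖ T ∣)   ≡⟨ cong suc (sym (∣∣-split {S = T} {Q} cols⊆Q)) ⟩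
          suc ∣ Q ∣                 ∎
          where open ≡-Reasoning

      growRows : ZeroBlock (P ∖ S) T (suc ∣ T ∣) → ZeroBlock P Q (suc ∣ Q ∣)
      growRows b′ = record
        { rows = S′ ∪ S ; cols = T′
        ; rows⊆P = λ i∈S′∪S → [ (λ i∈S′ → ∖⊆ {A = P} {B = S} (S′⊆P∖S i∈S′)) , rows⊆P ]′ (∪⁻ {A = S′} {S} i∈S′∪S)
        ; cols⊆Q = λ j∈T′ → cols⊆Q (T′⊆T j∈T′)
        ; vanishes = λ i∈S′∪S j∈T′ → [ (λ i∈S′ → vanishes′ i∈S′ j∈T′) , (λ i∈S → vanishes i∈S (T′⊆T j∈T′)) ]′
                                       (∪⁻ {A = S′} {S} i∈S′∪S)
        ; sized = size
        }
        where
        open ZeroBlock b′ renaming (rows to S′; cols to T′; rows⊆P to S′⊆P∖S; cols⊆Q to T′⊆T;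
                                    vanishes to vanishes′; sized to sized′)
        size : ∣ S′ ∪ S ∣ + ∣ T′ ∣ ≡ suc ∣ Q ∣
        size = begin
          ∣ S′ ∪ S ∣ + ∣ T′ ∣       ≡⟨ cong (_+ ∣ T′ ∣) (∣∣-∪ {A = S′} {S} λ i∈S′ → proj₂ (∖⁻ {A = P} {S} (S′⊆P∖S i∈S′))) ⟩
          ∣ S′ ∣ + ∣ S ∣ + ∣ T′ ∣   ≡⟨ +-assoc ∣ S′ ∣ _ _ ⟩
          ∣ S′ ∣ + (∣ S ∣ + ∣ T′ ∣) ≡⟨ cong (∣ S′ ∣ +_) (+-comm ∣ S ∣ _) ⟩
          ∣ S′ ∣ + (∣ T′ ∣ + ∣ S ∣) ≡⟨ sym (+-assoc ∣ S′ ∣ _ _) ⟩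
          ∣ S′ ∣ + ∣ T′ ∣ + ∣ S ∣   ≡⟨ cong (_+ ∣ S ∣) sized′ ⟩
          suc (∣ T ∣ + ∣ S ∣)       ≡⟨ cong suc (+-comm ∣ T ∣ _) ⟩
          suc (∣ S ∣ + ∣ T ∣)       ≡⟨ cong suc sized ⟩
          suc ∣ Q ∣                 ∎
          where open ≡-Reasoning

      recombine : HallAlternative S (Q ∖ T) → HallAlternative (P ∖ S) T → HallAlternative P Q
      recombine (inj₂ b′)  _          = inj₂ (growCols b′)
      recombine (inj₁ _)   (inj₂ b′)  = inj₂ (growRows b′)
      recombine (inj₁ m₁)  (inj₁ m₂)  = inj₁ (glueMatchings cols⊆Q m₁ m₂)

    remove-fuel : ∀ {P : Subset n} {r k} → r ∈ P → ∣ P ∣ < suc k → ∣ P - r ∣ < k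
    remove-fuel {P} {r} {k} r∈P ∣P∣<1+k = s≤s⁻¹ (subst (_< suc k) (∣∣-remove {P = P} {r} r∈P) ∣P∣<1+k)

    -- Pick r ∈ P.  If r has no neighbour in Q, ⁅ r ⁆ × Q is an obstruction.  Otherwise
    -- match r with a neighbour j and recurse on (P - r, Q - j); an obstruction there is a
    -- zero block S × T of size ∣ Q ∣ in P × Q, and we recurse on S → Q ∖ T and P ∖ S → T.
    hall : ∀ k (P Q : Subset n) → ∣ P ∣ < k → HallAlternative P Q
    hall (suc k) P Q ∣P∣<1+k with nonempty? P
    ... | inj₂ empty = inj₁ (emptyMatching empty)
    ... | inj₁ (r , r∈P) with nonempty? (Q ∩ R r)
    ...   | inj₂ noNeighbour = inj₂ (isolatedRow r∈P isolated)
      where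
      isolated : ∀ {j} → j ∈ Q → R r j ≡ false
      isolated {j} j∈Q with R r j in rRj
      ... | true  = ⊥-elim (noNeighbour (j , ∩⁺ {A = Q} {R r} j∈Q rRj))
      ... | false = refl
    ...   | inj₁ (j , j∈Q∩Rr) with ∩⁻ {A = Q} {R r} j∈Q∩Rr
    ...     | j∈Q , rRj with hall k (P - r) (Q - j) (remove-fuel r∈P ∣P∣<1+k)
    ...       | inj₁ m = inj₁ (extendMatching r∈P j∈Q rRj m)
    ...       | inj₂ b = recombine block (hall k S (Q ∖ T) ∣S∣<k) (hall k (P ∖ S) T ∣P∖S∣<k)
      where
      open ZeroBlock b renaming (rows to S; cols to T; rows⊆P to S⊆P-r)
      block : ZeroBlock P Q ∣ Q ∣
      block = widen (∖⊆ {A = P} {⁅ r ⁆}) (∖⊆ {A = Q} {⁅ j ⁆}) (sym (∣∣-remove {P = Q} {j} j∈Q)) b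
      ∣S∣<k : ∣ S ∣ < k
      ∣S∣<k = ≤-<-trans (∣∣-mono {S = S} S⊆P-r) (remove-fuel r∈P ∣P∣<1+k)
      ∣P∖S∣<k : ∣ P ∖ S ∣ < k
      ∣P∖S∣<k = <-≤-trans (subst (∣ P ∖ S ∣ <_) (sym (∣∣-split {S = S} (ZeroBlock.rows⊆P block)))
                                   (m<n+m ∣ P ∖ S ∣ (rows-nonempty b)))
                          (s≤s⁻¹ ∣P∣<1+k)

module Permutations where

  open import Data.Fin using (Fin; _≟_; punchOut)
  open import Data.Nat using (suc)
  open import Data.Fin.Permutation using (permutation)
  open import Data.Fin.Properties using (any?; punchOut-injective; <⇒notInjective)
  open import Data.Nat.Properties using (n<1+n)
  open import Data.Product using (proj₁; proj₂)
  open import Function.Definitions using (Injective)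
  open import Relation.Binary.PropositionalEquality using (_≡_; _≢_; sym)
  open import Relation.Nullary using (yes; no; contradiction)

  -- Pigeonhole: an injective map Fin n → Fin n is onto, since a missed value j would
  -- make punchOut j ∘ f an injection Fin (suc m) → Fin m.
  injective⇒surjective : ∀ {n} {f : Fin n → Fin n} → Injective _≡_ _≡_ f → ∀ j → ∃ λ i → f i ≡ j
  injective⇒surjective {suc m} {f} f-inj j with any? (λ i → f i ≟ j)
  ... | yes hit  = hit
  ... | no  miss = contradiction (λ {x} {y} → shrunk-injective {x} {y}) (<⇒notInjective (n<1+n m))
    where
    misses : ∀ i → j ≢ f i
    misses i j≡fi = miss (i , sym j≡fi)
    shrunk-injective : Injective _≡_ _≡_ (λ i → punchOut (misses i))
    shrunk-injective {x} {y} eq = f-inj (punchOut-injective (misses x) (misses y) eq)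

  toPermutation : ∀ {n} (f : Fin n → Fin n) → Injective _≡_ _≡_ f → Permutation′ n
  toPermutation f f-inj = permutation f (λ j → proj₁ (onto j)) (λ j → proj₂ (onto j))
                                        (λ i → f-inj (proj₂ (onto (f i))))
    where onto = injective⇒surjective f-inj

module Arithmetic where

  open import Data.Nat using (zero; suc; _+_; _*_; _≤_; _%_; _/_)
  open import Data.Nat.Properties
    using (≤-total; m≤n⇒∃[o]m+o≡n; +-identityʳ; +-comm; *-comm; m≤m+n; +-monoʳ-≤; +-cancelʳ-≤;
           even≢odd; module ≤-Reasoning)
  open import Data.Nat.DivMod using (m≡m%n+[m/n]*n)
  open import Data.Nat.Solver using (module +-*-Solver)
  open import Data.Empty using (⊥-elim)
  open import Data.Product using (_×_)
  open import Data.Sum using (inj₁; inj₂)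
  open import Relation.Binary.PropositionalEquality using (_≡_; refl; sym; trans; cong)

  -- (p + q)² = 4pq + d² where d = |p − q|; in particular d = 0 forces p = q.
  square-of-sum : ∀ p q → ∃ λ d → (p + q) * (p + q) ≡ 4 * p * q + d * d × (d ≡ 0 → p ≡ q)
  square-of-sum p q with ≤-total p q
  ... | inj₁ p≤q with d , refl ← m≤n⇒∃[o]m+o≡n p≤q =
    d , solve 2 (λ p d → (p :+ (p :+ d)) :* (p :+ (p :+ d)) := con 4 :* p :* (p :+ d) :+ d :* d) refl p d
      , λ { refl → sym (+-identityʳ p) }
    where open +-*-Solver
  ... | inj₂ q≤p with d , refl ← m≤n⇒∃[o]m+o≡n q≤p =
    d , solve 2 (λ q d → ((q :+ d) :+ q) :* ((q :+ d) :+ q) := con 4 :* (q :+ d) :* q :+ d :* d) refl q d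
      , λ { refl → +-identityʳ q }
    where open +-*-Solver

  four-pq≤odd : ∀ N p q → p + q ≡ suc N → 4 * p * q ≤ (N + 1) * (N + 1)
  four-pq≤odd N p q p+q≡1+N with square-of-sum p q
  ... | d , square , _ = begin
    4 * p * q                 ≤⟨ m≤m+n (4 * p * q) (d * d) ⟩
    4 * p * q + d * d         ≡⟨ square ⟨
    (p + q) * (p + q)         ≡⟨ cong (λ m → m * m) (trans p+q≡1+N (+-comm 1 N)) ⟩
    (N + 1) * (N + 1)         ∎
    where open ≤-Reasoning

  -- For N even, p + q = N + 1 is odd, so p ≠ q and the AM–GM bound improves by one:
  -- 4pq ≤ (N + 1)² − 1 = N (N + 2).
  four-pq≤even : ∀ N p q → N % 2 ≡ 0 → p + q ≡ suc N → 4 * p * q ≤ N * (N + 2)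
  four-pq≤even N p q N-even p+q≡1+N with square-of-sum p q
  ... | zero , _ , d≡0⇒p≡q with refl ← d≡0⇒p≡q refl =
    ⊥-elim (even≢odd p (N / 2) (begin-equality
      2 * p                 ≡⟨ cong (p +_) (+-identityʳ p) ⟩
      p + p                 ≡⟨ p+q≡1+N ⟩
      suc N                 ≡⟨ cong suc (m≡m%n+[m/n]*n N 2) ⟩
      suc (N % 2 + N / 2 * 2) ≡⟨ cong (λ r → suc (r + N / 2 * 2)) N-even ⟩
      suc (N / 2 * 2)       ≡⟨ cong suc (*-comm (N / 2) 2) ⟩
      suc (2 * (N / 2))     ∎))
    where open ≤-Reasoning
  ... | suc d , square , _ = +-cancelʳ-≤ 1 _ _ (begin
    4 * p * q + 1                 ≤⟨ +-monoʳ-≤ (4 * p * q) (m≤m+n 1 (d + d * suc d)) ⟩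
    4 * p * q + suc d * suc d     ≡⟨ square ⟨
    (p + q) * (p + q)             ≡⟨ cong (λ m → m * m) p+q≡1+N ⟩
    suc N * suc N                 ≡⟨ solve 1 (λ N → (con 1 :+ N) :* (con 1 :+ N) := N :* (N :+ con 2) :+ con 1) refl N ⟩
    N * (N + 2) + 1               ∎)
    where open ≤-Reasoning
          open +-*-Solver

module OrderedFieldFacts {c ℓ₁ ℓ₂ : Level} (F : OrderedField c ℓ₁ ℓ₂) where

  open import Data.Nat as ℕ using (zero; suc; z≤n; s≤s)
  open import Data.Empty using (⊥-elim)
  open import Data.Sum using (inj₁; inj₂)
  open import Relation.Binary.Bundles using (Poset)
  open import Relation.Binary.Structures using (IsTotalOrder)
  open import Relation.Nullary using (¬_)
  open import Relation.Binary.PropositionalEquality as ≡ using (_≡_)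
  open OrderedField F
  open IsTotalOrder isTotalOrder using (total; antisym; ≲-respˡ-≈; ≲-respʳ-≈)
    renaming (refl to ≤-refl; trans to ≤-trans; reflexive to ≤-reflexive)
  open import Algebra.Properties.Ring ring using (-‿distribʳ-*; -‿distribˡ-*; -‿involutive)
  open import Algebra.Properties.CommutativeSemigroup +-commutativeSemigroup
    using (xy∙z≈xz∙y; x∙yz≈xz∙y)
  open import Algebra.Properties.Semiring.Mult semiring using (×1-homo-*)
  import Algebra.Definitions.RawMonoid +-rawMonoid as Multiples

  poset : Poset c ℓ₁ ℓ₂
  poset = record { isPartialOrder = IsTotalOrder.isPartialOrder isTotalOrder }

  open import Relation.Binary.Reasoning.PartialOrder poset

  +-monoʳ-≤′ : ∀ z {x y} → x ≤ y → z + x ≤ z + y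
  +-monoʳ-≤′ z {x} {y} x≤y = begin
    z + x ≈⟨ +-comm z x ⟩
    x + z ≤⟨ +-mono-≤ z x≤y ⟩
    y + z ≈⟨ +-comm y z ⟩
    z + y ∎

  +-mono-≤₂ : ∀ {x y u v} → x ≤ y → u ≤ v → x + u ≤ y + v
  +-mono-≤₂ {x} {y} {u} {v} x≤y u≤v = begin
    x + u ≤⟨ +-mono-≤ u x≤y ⟩
    y + u ≤⟨ +-monoʳ-≤′ y u≤v ⟩
    y + v ∎

  +-cancelʳ-≤ : ∀ z {x y} → x + z ≤ y + z → x ≤ y
  +-cancelʳ-≤ z {x} {y} x+z≤y+z = begin
    x               ≈⟨ cancel x ⟨
    x + z + - z     ≤⟨ +-mono-≤ (- z) x+z≤y+z ⟩
    y + z + - z     ≈⟨ cancel y ⟩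
    y               ∎
    where
    cancel : ∀ w → w + z + - z ≈ w
    cancel w = trans (+-assoc w z (- z)) (trans (+-cong refl (-‿inverseʳ z)) (+-identityʳ w))

  +-cancelˡ-≤ : ∀ z {x y} → z + x ≤ z + y → x ≤ y
  +-cancelˡ-≤ z {x} {y} z+x≤z+y = +-cancelʳ-≤ z (begin
    x + z ≈⟨ +-comm x z ⟩
    z + x ≤⟨ z+x≤z+y ⟩
    z + y ≈⟨ +-comm z y ⟩
    y + z ∎)

  +-chain-≤ : ∀ {a b c′ d e f} → a + b ≤ c′ + d → d + e ≤ b + f → a + e ≤ c′ + f
  +-chain-≤ {a} {b} {c′} {d} {e} {f} h₁ h₂ = +-cancelʳ-≤ b (begin
    a + e + b       ≈⟨ xy∙z≈xz∙y a e b ⟩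
    a + b + e       ≤⟨ +-mono-≤ e h₁ ⟩
    c′ + d + e      ≈⟨ +-assoc c′ d e ⟩
    c′ + (d + e)    ≤⟨ +-monoʳ-≤′ c′ h₂ ⟩
    c′ + (b + f)    ≈⟨ x∙yz≈xz∙y c′ b f ⟩
    c′ + f + b      ∎)

  ≤⇒0≤- : ∀ {x y} → x ≤ y → 0# ≤ y + - x
  ≤⇒0≤- {x} {y} x≤y = begin
    0#      ≈⟨ -‿inverseʳ x ⟨
    x + - x ≤⟨ +-mono-≤ (- x) x≤y ⟩
    y + - x ∎

  ≤0⇒0≤- : ∀ {x} → x ≤ 0# → 0# ≤ - x
  ≤0⇒0≤- {x} x≤0 = ≲-respʳ-≈ (+-identityˡ (- x)) (≤⇒0≤- x≤0)

  -- In an ordered field 0 ≤ 1: otherwise 0 ≤ − 1 and so 0 ≤ (− 1)² = 1.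
  0≤1 : 0# ≤ 1#
  0≤1 with total 0# 1#
  ... | inj₁ 0≤1 = 0≤1
  ... | inj₂ 1≤0 = ⊥-elim (0≉1 (antisym (≲-respʳ-≈ [-1]²≈1 (*-nonneg 0≤-1 0≤-1)) 1≤0))
    where
    0≤-1 : 0# ≤ - 1#
    0≤-1 = ≤0⇒0≤- 1≤0
    [-1]²≈1 : - 1# * - 1# ≈ 1#
    [-1]²≈1 = trans (sym (-‿distribʳ-* (- 1#) 1#)) (trans (-‿cong (*-identityʳ (- 1#))) (-‿involutive 1#))

  *-monoʳ-≤ : ∀ {x y} z → 0# ≤ z → x ≤ y → x * z ≤ y * z
  *-monoʳ-≤ {x} {y} z 0≤z x≤y = begin
    x * z                     ≈⟨ +-identityˡ (x * z) ⟨
    0# + x * z                ≤⟨ +-mono-≤ (x * z) (*-nonneg (≤⇒0≤- x≤y) 0≤z) ⟩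
    (y + - x) * z + x * z     ≈⟨ +-cong (distribʳ z y (- x)) refl ⟩
    y * z + - x * z + x * z   ≈⟨ +-assoc (y * z) (- x * z) (x * z) ⟩
    y * z + (- x * z + x * z) ≈⟨ +-cong refl (trans (+-cong (sym (-‿distribˡ-* x z)) refl) (-‿inverseˡ (x * z))) ⟩
    y * z + 0#                ≈⟨ +-identityʳ (y * z) ⟩
    y * z                     ∎

  -- The inverse of a positive element is non-negative: otherwise 0 ≤ x · (− x⁻¹) = − 1.
  ⁻¹-nonneg : ∀ {x} → ¬ (x ≈ 0#) → 0# ≤ x → 0# ≤ x ⁻¹
  ⁻¹-nonneg {x} x≉0 0≤x with total 0# (x ⁻¹)
  ... | inj₁ 0≤x⁻¹ = 0≤x⁻¹
  ... | inj₂ x⁻¹≤0 = ⊥-elim (0≉1 (antisym 0≤1 1≤0))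
    where
    0≤-1 : 0# ≤ - 1#
    0≤-1 = ≲-respʳ-≈ (trans (sym (-‿distribʳ-* x (x ⁻¹))) (-‿cong (⁻¹-inverse x x≉0)))
                     (*-nonneg 0≤x (≤0⇒0≤- x⁻¹≤0))
    1≤0 : 1# ≤ 0#
    1≤0 = begin
      1#        ≈⟨ +-identityʳ 1# ⟨
      1# + 0#   ≤⟨ +-monoʳ-≤′ 1# 0≤-1 ⟩
      1# + - 1# ≈⟨ -‿inverseʳ 1# ⟩
      0#        ∎

  fromℕ≡× : ∀ n → fromℕ F n ≡ n Multiples.× 1#
  fromℕ≡× zero    = ≡.refl
  fromℕ≡× (suc n) = ≡.cong (1# +_) (fromℕ≡× n)

  fromℕ-* : ∀ m n → fromℕ F (m ℕ.* n) ≈ fromℕ F m * fromℕ F n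
  fromℕ-* m n rewrite fromℕ≡× (m ℕ.* n) | fromℕ≡× m | fromℕ≡× n = ×1-homo-* m n

  0≤fromℕ : ∀ n → 0# ≤ fromℕ F n
  0≤fromℕ zero    = ≤-refl
  0≤fromℕ (suc n) = ≲-respˡ-≈ (+-identityʳ 0#) (+-mono-≤₂ 0≤1 (0≤fromℕ n))

  fromℕ-mono : ∀ {m n} → m ℕ.≤ n → fromℕ F m ≤ fromℕ F n
  fromℕ-mono {n = n} z≤n   = 0≤fromℕ n
  fromℕ-mono (s≤s m≤n)    = +-monoʳ-≤′ 1# (fromℕ-mono m≤n)

  fromℕ-suc≉0 : ∀ n → ¬ (fromℕ F (suc n) ≈ 0#)
  fromℕ-suc≉0 n 1+n≈0 = 0≉1 (antisym 0≤1 (begin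
    1#            ≈⟨ +-identityʳ 1# ⟨
    1# + 0#       ≤⟨ +-monoʳ-≤′ 1# (0≤fromℕ n) ⟩
    fromℕ F (suc n) ≈⟨ 1+n≈0 ⟩
    0#            ∎))

module FieldSums {c ℓ₁ ℓ₂ : Level} (F : OrderedField c ℓ₁ ℓ₂) where

  open import Data.Bool using (true; false; if_then_else_; _∧_; not)
  open import Data.Fin using (Fin; zero; suc)
  open import Data.Nat as ℕ using (zero; suc)
  open import Relation.Binary.PropositionalEquality as ≡ using (_≡_)
  open FiniteSubsets
  open OrderedFieldFacts F
  open OrderedField F hiding (zero)
  open import Relation.Binary.Structures using (IsTotalOrder)
  open IsTotalOrder isTotalOrder using (≲-respˡ-≈) renaming (refl to ≤-refl; reflexive to ≤-reflexive)
  open import Algebra.Properties.Semiring.Sum semiring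
    using (sum; sum-cong-≋; ∑-distrib-+; ∑-comm; sum-replicate-zero)
  open import Relation.Binary.Reasoning.PartialOrder poset

  Σ≡sum : ∀ {n} (f : Fin n → Carrier) → Σ F f ≡ sum f
  Σ≡sum {zero}  f = ≡.refl
  Σ≡sum {suc n} f = ≡.cong (f zero +_) (Σ≡sum (λ i → f (suc i)))

  sum-mono : ∀ {n} {f g : Fin n → Carrier} → (∀ i → f i ≤ g i) → sum f ≤ sum g
  sum-mono {zero}  f≤g = ≤-refl
  sum-mono {suc n} f≤g = +-mono-≤₂ (f≤g zero) (sum-mono (λ i → f≤g (suc i)))

  module _ {n : ℕ} where

    sumOver : Subset n → (Fin n → Carrier) → Carrier
    sumOver S f = sum (λ i → if S i then f i else 0#)

    sumOver-cong : ∀ S {f g} → (∀ i → f i ≈ g i) → sumOver S f ≈ sumOver S g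
    sumOver-cong S {f} {g} f≈g = sum-cong-≋ {n} pointwise
      where
      pointwise : ∀ i → (if S i then f i else 0#) ≈ (if S i then g i else 0#)
      pointwise i with S i
      ... | true  = f≈g i
      ... | false = refl

    sumOver-+ : ∀ S (f g : Fin n → Carrier) → sumOver S (λ i → f i + g i) ≈ sumOver S f + sumOver S g
    sumOver-+ S f g = trans (sum-cong-≋ {n} pointwise) (∑-distrib-+ {n} _ _)
      where
      pointwise : ∀ i → (if S i then f i + g i else 0#) ≈ (if S i then f i else 0#) + (if S i then g i else 0#)
      pointwise i with S i
      ... | true  = refl
      ... | false = sym (+-identityʳ 0#)

    sumOver-nonneg : ∀ S {f} → (∀ i → 0# ≤ f i) → 0# ≤ sumOver S f
    sumOver-nonneg S {f} 0≤f = ≲-respˡ-≈ (sum-replicate-zero n) (sum-mono pointwise)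
      where
      pointwise : ∀ i → 0# ≤ (if S i then f i else 0#)
      pointwise i with S i
      ... | true  = 0≤f i
      ... | false = ≤-refl

    sumOver-mono : ∀ S {f g} → (∀ {i} → i ∈ S → f i ≤ g i) → sumOver S f ≤ sumOver S g
    sumOver-mono S {f} {g} f≤g = sum-mono pointwise
      where
      pointwise : ∀ i → (if S i then f i else 0#) ≤ (if S i then g i else 0#)
      pointwise i with S i in i∈S
      ... | true  = f≤g i∈S
      ... | false = ≤-refl

    sumOver≤sum : ∀ S {f} → (∀ i → 0# ≤ f i) → sumOver S f ≤ sum f
    sumOver≤sum S {f} 0≤f = sum-mono pointwise
      where
      pointwise : ∀ i → (if S i then f i else 0#) ≤ f i
      pointwise i with S i
      ... | true  = ≤-refl
      ... | false = 0≤f i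

    sum-split : ∀ S (f : Fin n → Carrier) → sum f ≈ sumOver S f + sumOver (full ∖ S) f
    sum-split S f = trans (sum-cong-≋ {n} pointwise) (∑-distrib-+ {n} _ _)
      where
      pointwise : ∀ i → f i ≈ (if S i then f i else 0#) + (if full i ∧ not (S i) then f i else 0#)
      pointwise i with S i
      ... | true  = sym (+-identityʳ (f i))
      ... | false = sym (+-identityˡ (f i))

    sum-sumOver-comm : ∀ T (f : Fin n → Fin n → Carrier) →
                       sum (λ i → sumOver T (f i)) ≈ sumOver T (λ j → sum (λ i → f i j))
    sum-sumOver-comm T f = trans (∑-comm {n} {n} (λ i j → if T j then f i j else 0#)) (sum-cong-≋ {n} pointwise)
      where
      pointwise : ∀ j → sum (λ i → if T j then f i j else 0#) ≈ (if T j then sum (λ i → f i j) else 0#)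
      pointwise j with T j
      ... | true  = refl
      ... | false = sum-replicate-zero n

  sumOver-single : ∀ {n} k (f : Fin n → Carrier) → sumOver ⁅ k ⁆ f ≈ f k
  sumOver-single {suc n} zero    f = trans (+-cong refl (sum-replicate-zero n)) (+-identityʳ (f zero))
  sumOver-single {suc n} (suc k) f = trans (+-identityˡ _) (sumOver-single k (λ i → f (suc i)))

  opaque
    unfolding ∣_∣

    sumOver-const : ∀ {n} (S : Subset n) x → sumOver S (λ _ → x) ≈ x * fromℕ F ∣ S ∣
    sumOver-const {zero}  S x = sym (zeroʳ x)
    sumOver-const {suc n} S x = step (S zero) (sumOver-const (λ i → S (suc i)) x)
      where
      step : ∀ b {y m} → y ≈ x * fromℕ F m → (if b then x else 0#) + y ≈ x * fromℕ F (𝟙 b ℕ.+ m)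
      step true  {y} {m} y≈xm = trans (+-cong (sym (*-identityʳ x)) y≈xm) (sym (distribˡ x 1# (fromℕ F m)))
      step false     y≈xm = trans (+-identityˡ _) y≈xm

  unit-lines : ∀ {n} (S : Subset n) (g : Fin n → Fin n → Carrier) → (∀ i → Σ F (g i) ≈ 1#) →
               sumOver S (λ i → sum (g i)) ≈ fromℕ F ∣ S ∣
  unit-lines S g unit = begin-equality
    sumOver S (λ i → sum (g i)) ≈⟨ sumOver-cong S (λ i → ≡.subst (_≈ 1#) (Σ≡sum (g i)) (unit i)) ⟩
    sumOver S (λ _ → 1#)        ≈⟨ sumOver-const S 1# ⟩
    1# * fromℕ F ∣ S ∣          ≈⟨ *-identityˡ _ ⟩
    fromℕ F ∣ S ∣               ∎

  sumOver-concentration : ∀ {n} (S : Subset n) {f x k} → (∀ {i} → i ∈ S → f i ≤ x) → k ∈ S →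
                          sumOver S f + x ≤ x * fromℕ F ∣ S ∣ + f k
  sumOver-concentration {n} S {f} {x} {k} f≤x k∈S = begin
    sumOver S f + x                           ≈⟨ +-cong refl (sumOver-single k (λ _ → x)) ⟨
    sumOver S f + sumOver ⁅ k ⁆ (λ _ → x)     ≈⟨ ∑-distrib-+ {n} _ _ ⟨
    sum (λ i → lhs i)                         ≤⟨ sum-mono pointwise ⟩
    sum (λ i → rhs i)                         ≈⟨ ∑-distrib-+ {n} _ _ ⟩
    sumOver S (λ _ → x) + sumOver ⁅ k ⁆ f     ≈⟨ +-cong (sumOver-const S x) (sumOver-single k f) ⟩
    x * fromℕ F ∣ S ∣ + f k                   ∎
    where
    lhs rhs : Fin n → Carrier
    lhs i = (if S i then f i else 0#) + (if ⁅ k ⁆ i then x else 0#)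
    rhs i = (if S i then x else 0#) + (if ⁅ k ⁆ i then f i else 0#)
    pointwise : ∀ i → lhs i ≤ rhs i
    pointwise i with ⁅ k ⁆ i in i∈⁅k⁆
    pointwise i | true with ≡.refl ← ∈⁅⁆ {r = k} {i} i∈⁅k⁆ rewrite k∈S = ≤-reflexive (+-comm (f i) x)
    pointwise i | false with S i in i∈S
    ... | true  = +-mono-≤ 0# (f≤x i∈S)
    ... | false = ≤-refl

module BlockLemma {c ℓ₁ ℓ₂ : Level} (F : OrderedField c ℓ₁ ℓ₂) where

  open import Data.Nat as ℕ using (suc)
  import Data.Nat.Properties as ℕ
  open import Relation.Binary.PropositionalEquality as ≡ using (_≡_)
  open FiniteSubsets
  open OrderedFieldFacts F
  open FieldSums F
  open OrderedField F hiding (zero)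
  open import Relation.Binary.Structures using (IsTotalOrder)
  open IsTotalOrder isTotalOrder using () renaming (trans to ≤-trans; reflexive to ≤-reflexive)
  open import Algebra.Properties.Semiring.Sum semiring using (sum)
  open import Relation.Binary.Reasoning.PartialOrder poset

  module _ {N : ℕ} (B : Matrix F N) (nonneg : ∀ i j → 0# ≤ B i j)
           (rowSum : ∀ i → Σ F (λ j → B i j) ≈ 1#) (colSum : ∀ j → Σ F (λ i → B i j) ≈ 1#) where

    mass : Subset N → Subset N → Carrier
    mass S T = sumOver S (λ i → sumOver T (B i))

    -- A block S × T with ∣ S ∣ + ∣ T ∣ = N + 1 carries mass at least 1: its rows carry
    -- ∣ S ∣ = 1 + ∣ T̅ ∣, of which the columns T̅ outside T absorb at most ∣ T̅ ∣.
    mass≥1 : ∀ S T → ∣ S ∣ ℕ.+ ∣ T ∣ ≡ suc N → 1# ≤ mass S T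
    mass≥1 S T size = +-cancelʳ-≤ (fromℕ F ∣ T̅ ∣) (begin
      1# + fromℕ F ∣ T̅ ∣                                   ≡⟨ ≡.cong (fromℕ F) ∣S∣≡1+∣T̅∣ ⟨
      fromℕ F ∣ S ∣                                         ≈⟨ unit-lines S B rowSum ⟨
      sumOver S (λ i → sum (B i))                           ≈⟨ sumOver-cong S (λ i → sum-split T (B i)) ⟩
      sumOver S (λ i → sumOver T (B i) + sumOver T̅ (B i))   ≈⟨ sumOver-+ S _ _ ⟩
      mass S T + mass S T̅                                   ≤⟨ +-monoʳ-≤′ (mass S T) outside ⟩
      mass S T + fromℕ F ∣ T̅ ∣                              ∎)
      where
      T̅ : Subset N
      T̅ = full ∖ T
      ∣S∣≡1+∣T̅∣ : ∣ S ∣ ≡ suc ∣ T̅ ∣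
      ∣S∣≡1+∣T̅∣ = ℕ.+-cancelʳ-≡ ∣ T ∣ ∣ S ∣ (suc ∣ T̅ ∣)
                    (≡.trans size (≡.cong suc (≡.trans (≡.sym (∣∣-complement T)) (ℕ.+-comm ∣ T ∣ ∣ T̅ ∣))))
      outside : mass S T̅ ≤ fromℕ F ∣ T̅ ∣
      outside = begin
        mass S T̅                              ≤⟨ sumOver≤sum S (λ i → sumOver-nonneg T̅ (nonneg i)) ⟩
        sum (λ i → sumOver T̅ (B i))           ≈⟨ sum-sumOver-comm T̅ B ⟩
        sumOver T̅ (λ j → sum (λ i → B i j))   ≈⟨ unit-lines T̅ (λ j i → B i j) colSum ⟩
        fromℕ F ∣ T̅ ∣                         ∎

    -- Let S × T be a block with ∣ S ∣ + ∣ T ∣ = N + 1 on which all entries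
    -- are at most t, where t · ∣ T ∣ · ∣ S ∣ ≤ 1.  Then every entry of the block is at least t:
    -- a single entry below t would push the mass of the block below t · ∣ T ∣ · ∣ S ∣ ≤ 1.
    block-lemma : ∀ {S T t} → ∣ S ∣ ℕ.+ ∣ T ∣ ≡ suc N → (∀ {i j} → i ∈ S → j ∈ T → B i j ≤ t) →
                  t * fromℕ F ∣ T ∣ * fromℕ F ∣ S ∣ ≤ 1# → ∀ {i₀ j₀} → i₀ ∈ S → j₀ ∈ T → t ≤ B i₀ j₀
    block-lemma {S} {T} {t} size B≤t small {i₀} {j₀} i₀∈S j₀∈T = +-cancelˡ-≤ (mass S T) (begin
      mass S T + t                            ≤⟨ +-chain-≤ across-rows within-row ⟩
      t * fromℕ F ∣ T ∣ * fromℕ F ∣ S ∣ + B i₀ j₀ ≤⟨ +-mono-≤ (B i₀ j₀) (≤-trans small (mass≥1 S T size)) ⟩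
      mass S T + B i₀ j₀                      ∎)
      where
      row≤ : ∀ {i} → i ∈ S → sumOver T (B i) ≤ t * fromℕ F ∣ T ∣
      row≤ i∈S = ≤-trans (sumOver-mono T (B≤t i∈S)) (≤-reflexive (sumOver-const T t))
      within-row : sumOver T (B i₀) + t ≤ t * fromℕ F ∣ T ∣ + B i₀ j₀
      within-row = sumOver-concentration T (B≤t i₀∈S) j₀∈T
      across-rows : mass S T + t * fromℕ F ∣ T ∣ ≤ t * fromℕ F ∣ T ∣ * fromℕ F ∣ S ∣ + sumOver T (B i₀)
      across-rows = sumOver-concentration S row≤ i₀∈S

module TwoAlphaBound {c ℓ₁ ℓ₂ : Level} (F : OrderedField c ℓ₁ ℓ₂) where

  open Arithmetic
  open import Data.Nat as ℕ using (zero; suc; _%_)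
  open import Relation.Binary.PropositionalEquality using (_≡_)
  open OrderedField F hiding (zero)
  open OrderedFieldFacts F
  open import Algebra.Properties.CommutativeSemigroup *-commutativeSemigroup using (xy∙z≈xz∙y)
  open import Relation.Binary.Reasoning.PartialOrder poset

  four-over-bound : ∀ p q D → 4 ℕ.* p ℕ.* q ℕ.≤ suc D →
                    fromℕ F 4 * fromℕ F (suc D) ⁻¹ * fromℕ F p * fromℕ F q ≤ 1#
  four-over-bound p q D 4pq≤D = begin
    fromℕ F 4 * D⁻¹ * fromℕ F p * fromℕ F q     ≈⟨ *-cong (xy∙z≈xz∙y (fromℕ F 4) D⁻¹ (fromℕ F p)) refl ⟩
    fromℕ F 4 * fromℕ F p * D⁻¹ * fromℕ F q     ≈⟨ xy∙z≈xz∙y (fromℕ F 4 * fromℕ F p) D⁻¹ (fromℕ F q) ⟩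
    fromℕ F 4 * fromℕ F p * fromℕ F q * D⁻¹     ≈⟨ *-cong (trans (fromℕ-* (4 ℕ.* p) q) (*-cong (fromℕ-* 4 p) refl)) refl ⟨
    fromℕ F (4 ℕ.* p ℕ.* q) * D⁻¹               ≤⟨ *-monoʳ-≤ D⁻¹ (⁻¹-nonneg (fromℕ-suc≉0 D) (0≤fromℕ (suc D))) (fromℕ-mono 4pq≤D) ⟩
    fromℕ F (suc D) * D⁻¹                       ≈⟨ ⁻¹-inverse (fromℕ F (suc D)) (fromℕ-suc≉0 D) ⟩
    1#                                          ∎
    where
    D⁻¹ : Carrier
    D⁻¹ = fromℕ F (suc D) ⁻¹

  twoAlpha-bound : ∀ N p q → N ≥ 1 → p ℕ.+ q ≡ suc N → twoAlpha F N * fromℕ F p * fromℕ F q ≤ 1#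
  twoAlpha-bound (suc M) p q _ p+q≡N+1 with suc M % 2 in parity
  ... | zero  = four-over-bound p q _ (four-pq≤even (suc M) p q parity p+q≡N+1)
  ... | suc _ = four-over-bound p q _ (four-pq≤odd (suc M) p q p+q≡N+1)

module Theorem where

  open FiniteSubsets
  open Hall
  open Permutations
  open import Data.Bool using (Bool; true; false; not; _∧_; if_then_else_)
  open import Data.Empty using (⊥-elim)
  open import Data.Fin using (Fin; _≟_)
  open import Data.Fin.Permutation using (_⟨$⟩ʳ_)
  open import Data.Nat as ℕ using (suc; s≤s; s≤s⁻¹)
  import Data.Nat.Properties as ℕ
  open import Data.Product using (_×_; proj₁; proj₂)
  open import Data.Sum using (inj₁; inj₂)
  open import Relation.Binary.PropositionalEquality as ≡ using (_≡_)
  open import Relation.Binary.Structures using (IsTotalOrder)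
  open import Relation.Nullary using (yes; no)
  open import Relation.Nullary.Decidable using (does)
  open import Algebra.Properties.CommutativeMonoid.Sum ℕ.+-0-commutativeMonoid using (sum)

  module _ {c ℓ₁ ℓ₂ : Level} (F : OrderedField c ℓ₁ ℓ₂) where
    open OrderedField F hiding (zero)
    open IsTotalOrder isTotalOrder using (total)
    open BlockLemma F
    open TwoAlphaBound F

    permMatrix-support : ∀ {N} (σ : Permutation′ N) i j → ¬ (permMatrix F σ i j ≈ 0#) → σ ⟨$⟩ʳ i ≡ j
    permMatrix-support σ i j nonzero with σ ⟨$⟩ʳ i ≟ j
    ... | yes σi≡j = σi≡j
    ... | no  _    = ⊥-elim (nonzero refl)

    module _ {N : ℕ} (B : Matrix F N) (nonneg : ∀ i j → 0# ≤ B i j)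
             (rowSum : ∀ i → Σ F (λ j → B i j) ≈ 1#) (colSum : ∀ j → Σ F (λ i → B i j) ≈ 1#) where

      PermutationAbove : Carrier → Set (ℓ₁ Level.⊔ ℓ₂)
      PermutationAbove x = ∃ λ (σ : Permutation′ N) → ∀ i j → ¬ (permMatrix F σ i j ≈ 0#) → x ≤ B i j

      record Marking (x : Carrier) : Set (ℓ₁ Level.⊔ ℓ₂) where
        field
          marked : Fin N → Fin N → Bool
          above  : ∀ {i j} → marked i j ≡ true  → x ≤ B i j
          below  : ∀ {i j} → marked i j ≡ false → B i j ≤ x

        unmarkedIn : Fin N → Subset N
        unmarkedIn i j = not (marked i j)

        unmarked : ℕ
        unmarked = sum (λ i → ∣ unmarkedIn i ∣)

      open Marking

      initialMarking : ∀ x → Marking x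
      initialMarking x = record
        { marked = λ i j → decide i j .proj₁
        ; above  = λ {i} {j} → decide i j .proj₂ .proj₁
        ; below  = λ {i} {j} → decide i j .proj₂ .proj₂
        }
        where
        decide : ∀ i j → ∃ λ b → (b ≡ true → x ≤ B i j) × (b ≡ false → B i j ≤ x)
        decide i j with total x (B i j)
        ... | inj₁ x≤Bij = true  , (λ _ → x≤Bij) , λ ()
        ... | inj₂ Bij≤x = false , (λ ()) , (λ _ → Bij≤x)

      matching⇒above : ∀ {x} (M : Marking x) → Matching (marked M) full full → PermutationAbove x
      matching⇒above M m = σ , λ i j nonzero →
        ≡.subst (λ k → _ ≤ B i k) (permMatrix-support σ i j nonzero) (above M (m.adjacent ≡.refl))
        where
        module m = Matching m
        σ = toPermutation m.match (m.injective ≡.refl ≡.refl)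

      mark : ∀ {x} (M : Marking x) i₀ j₀ → x ≤ B i₀ j₀ → Marking x
      mark {x} M i₀ j₀ x≤B₀ = record { marked = marked′ ; above = above′ ; below = below′ }
        where
        marked′ : Fin N → Fin N → Bool
        marked′ i j = if does (i ≟ i₀) ∧ does (j ≟ j₀) then true else marked M i j
        above′ : ∀ {i j} → marked′ i j ≡ true → x ≤ B i j
        above′ {i} {j} marked′ij with i ≟ i₀ | j ≟ j₀
        ... | yes ≡.refl | yes ≡.refl = x≤B₀
        ... | yes _      | no  _      = above M marked′ij
        ... | no  _      | _          = above M marked′ij
        below′ : ∀ {i j} → marked′ i j ≡ false → B i j ≤ x
        below′ {i} {j} unmarked′ij with i ≟ i₀ | j ≟ j₀
        ... | yes _ | yes _ with () ← unmarked′ij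
        ... | yes _ | no _ = below M unmarked′ij
        ... | no  _ | _    = below M unmarked′ij

      mark-decreases : ∀ {x} (M : Marking x) {i₀ j₀} (x≤B₀ : x ≤ B i₀ j₀) → marked M i₀ j₀ ≡ false →
                       unmarked (mark M i₀ j₀ x≤B₀) ℕ.< unmarked M
      mark-decreases M {i₀} {j₀} x≤B₀ unmarked₀ =
        ∑-mono-< (λ i → ∣∣-mono (fewer i)) i₀ (∣∣-mono-< (fewer i₀) (≡.cong not unmarked₀) newly-marked)
        where
        M′ = mark M i₀ j₀ x≤B₀
        fewer : ∀ i → unmarkedIn M′ i ⊆ unmarkedIn M i
        fewer i {j} j∈unmarked′ with i ≟ i₀ | j ≟ j₀
        ... | yes _ | yes _ with () ← j∈unmarked′
        ... | yes _ | no  _ = j∈unmarked′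
        ... | no  _ | _     = j∈unmarked′
        newly-marked : j₀ ∉ unmarkedIn M′ i₀
        newly-marked with i₀ ≟ i₀ | j₀ ≟ j₀
        ... | yes _ | yes _  = ≡.refl
        ... | no  i₀≢i₀ | _  = ⊥-elim (i₀≢i₀ ≡.refl)
        ... | yes _ | no j₀≢j₀ = ⊥-elim (j₀≢j₀ ≡.refl)

      -- An obstruction to a marked perfect matching, at threshold 2α(N), contains an
      -- unmarked entry which the block lemma shows to lie above 2α(N) after all.
      obstruction⇒entry : N ≥ 1 → (M : Marking (twoAlpha F N)) →
                          ZeroBlock (marked M) full full (suc ∣ full {N} ∣) →
                          ∃ λ i₀ → ∃ λ j₀ → marked M i₀ j₀ ≡ false × twoAlpha F N ≤ B i₀ j₀
      obstruction⇒entry N≥1 M b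
        with i₀ , i₀∈S ← positive⇒nonempty (rows-nonempty _ b)
           | j₀ , j₀∈T ← positive⇒nonempty (cols-nonempty _ ℕ.≤-refl b)
        = i₀ , j₀ , vanishes i₀∈S j₀∈T ,
          block-lemma B nonneg rowSum colSum size (λ i∈S j∈T → below M (vanishes i∈S j∈T))
                      (twoAlpha-bound N ∣ T ∣ ∣ S ∣ N≥1 (≡.trans (ℕ.+-comm ∣ T ∣ ∣ S ∣) size)) i₀∈S j₀∈T
        where
        open ZeroBlock b renaming (rows to S; cols to T)
        size : ∣ S ∣ ℕ.+ ∣ T ∣ ≡ suc N
        size = ≡.trans sized (≡.cong suc ∣full∣)

      -- Alternate Hall's theorem and the block lemma, by induction on the number of
      -- unmarked entries (with fuel k): either the marked entries carry a perfect matching,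
      -- or an obstruction reveals a further entry above 2α(N) to mark.
      search : N ≥ 1 → ∀ k (M : Marking (twoAlpha F N)) → unmarked M ℕ.< k → PermutationAbove (twoAlpha F N)
      search N≥1 (suc k) M fuel with hall (marked M) (suc N) full full (s≤s (ℕ.≤-reflexive ∣full∣))
      ... | inj₁ m = matching⇒above M m
      ... | inj₂ b with i₀ , j₀ , unmarked₀ , above₀ ← obstruction⇒entry N≥1 M b =
        search N≥1 k (mark M i₀ j₀ above₀) (ℕ.<-≤-trans (mark-decreases M above₀ unmarked₀) (s≤s⁻¹ fuel))

      bistochastic⇒above-2α : N ≥ 1 → PermutationAbove (twoAlpha F N)
      bistochastic⇒above-2α N≥1 = search N≥1 (suc (unmarked M₀)) M₀ ℕ.≤-refl
        where M₀ = initialMarking (twoAlpha F N)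

lemma2 : ∀ {c ℓ₁ ℓ₂ : Level} (F : OrderedField c ℓ₁ ℓ₂) (N : ℕ) → N ≥ 1 →
           (B : Matrix F N) → BiStochastic F B →
           ∃ λ (σ : Permutation′ N) →
             ∀ i j → ¬ (OrderedField._≈_ F (permMatrix F σ i j) (OrderedField.0# F)) →
               OrderedField._≤_ F (twoAlpha F N) (B i j)
lemma2 F N N≥1 B (nonneg , rowSum , colSum) = Theorem.bistochastic⇒above-2α F B nonneg rowSum colSum N≥1
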